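{- Let $G$ be a finite simple graph with $n$ vertices and clique number $\omega$. Then: (i) $\eta(G) \geq \frac{\omega}{n-\omega+1}$; (ii) if $G$ is regular and $\omega > \frac{n+4}{3}$, then $\eta(G) \geq 3$.
   Context: For a vertex $v$, $N(v)$ denotes its set of neighbours. An additive labeling of a graph $G$ is a function $\ell: V(G) \to \mathbb{N}$ (positive integers) such that for every two adjacent vertices $u,v$ of $G$, $\sum_{w \in N(v)} \ell(w) \neq \sum_{w \in N(u)} \ell(w)$. The additive number $\eta(G)$ is the minimum $k$ such that $G$ has an additive labeling $\ell: V(G) \to \{1,\dots,k\}$. The clique number $\omega$ is the maximum number of pairwise adjacent vertices of $G$. -}

module Defs where

open import Data.Nat using (ℕ; zero; suc; _+_; _*_; _≤_; _<_)
open import Data.Bool using (Bool; true; false; if_then_else_)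
open import Data.Fin using (Fin)
open import Data.Fin.Subset using (Subset; _∈_; ∣_∣)
open import Data.Product using (Σ; _×_; ∃)
open import Relation.Binary.PropositionalEquality using (_≡_; _≢_)

record Graph (n : ℕ) : Set where
  field
    adj     : Fin n → Fin n → Bool
    symm    : ∀ u v → adj u v ≡ adj v u
    irrefl  : ∀ v → adj v v ≡ false
open Graph public

Adjacent : ∀ {n} → Graph n → Fin n → Fin n → Set
Adjacent G u v = adj G u v ≡ true

sumFin : ∀ n → (Fin n → ℕ) → ℕ
sumFin zero    f = 0
sumFin (suc n) f = f Fin.zero + sumFin n (λ i → f (Fin.suc i))

nbrSum : ∀ {n} → Graph n → (Fin n → ℕ) → Fin n → ℕ
nbrSum {n} G ℓ v = sumFin n (λ w → if adj G v w then ℓ w else 0)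

degree : ∀ {n} → Graph n → Fin n → ℕ
degree G v = nbrSum G (λ _ → 1) v

Regular : ∀ {n} → Graph n → Set
Regular G = ∃ λ d → ∀ v → degree G v ≡ d

IsAdditiveLabeling : ∀ {n} → Graph n → ℕ → (Fin n → ℕ) → Set
IsAdditiveLabeling G k ℓ =
  (∀ v → 1 ≤ ℓ v × ℓ v ≤ k) ×
  (∀ u v → Adjacent G u v → nbrSum G ℓ u ≢ nbrSum G ℓ v)

HasAdditiveLabeling : ∀ {n} → Graph n → ℕ → Set
HasAdditiveLabeling G k = Σ _ (IsAdditiveLabeling G k)

IsClique : ∀ {n} → Graph n → Subset n → Set
IsClique G S = ∀ u v → u ∈ S → v ∈ S → u ≢ v → Adjacent G u v

IsCliqueNumber : ∀ {n} → Graph n → ℕ → Set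
IsCliqueNumber G ω =
  (Σ _ λ S → IsClique G S × ∣ S ∣ ≡ ω) ×
  (∀ S → IsClique G S → ∣ S ∣ ≤ ω)

-- If K is a clique and v ∈ K, the neighbourhood sum of v satisfies
--   nbrSum v + ℓ v = ℓ(K) + ℓ(neighbours of v outside K),
-- so the neighbour sums of the vertices of K, which are pairwise distinct, all lie in a window
-- of k (n − ω + 1) consecutive values; this gives (i). If G is regular and ℓ takes values in
-- {1, 2}, every v ∈ K has the same number c of neighbours and c′ of non-neighbours outside K.
-- Reading the identity once through the neighbours and once (after adding the non-neighbours)
-- through ℓ(V) puts the neighbour sums in windows of lengths c + 2 and c′ + 2, and adding the two
-- bounds gives 2ω ≤ (n − ω) + 4, i.e. (ii).
module Submission where

import Algebra.Properties.CommutativeSemigroup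
open import Data.Bool using (Bool; true; false; not; _∧_; if_then_else_)
open import Data.Bool.Properties using (∧-comm)
open import Data.Fin using (Fin; zero; suc)
import Data.Fin.Properties as Fin
open import Data.Fin.Subset using (Subset; ∣_∣)
open import Data.Fin.Subset.Properties using (nonempty?; Empty-unique; ∣⊥∣≡0)
open import Data.List using ([]; _∷_)
open import Data.Nat using (ℕ; zero; suc; pred; _+_; _*_; _∸_; _≤_; _<_; z≤n; s≤s; s≤s⁻¹)
open import Data.Nat.Properties
open import Data.Nat.Tactic.RingSolver using (solve; solve-∀)
open import Data.Product using (∃; _×_; _,_; proj₁; proj₂)
open import Data.Vec using (lookup)
import Data.Vec as Vec
open import Data.Vec.Properties using ([]=⇒lookup; lookup⇒[]=)
open import Function using (_∘_; const)
open import Relation.Binary.PropositionalEquality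
open import Relation.Nullary using (yes; no; contradiction)
open import Relation.Nullary.Decidable using (decidable-stable)

open import Defs

private
  module +-CS = Algebra.Properties.CommutativeSemigroup +-commutativeSemigroup

sumFin-cong : ∀ {n} {f g : Fin n → ℕ} → (∀ w → f w ≡ g w) → sumFin n f ≡ sumFin n g
sumFin-cong {zero}  f≗g = refl
sumFin-cong {suc n} f≗g = cong₂ _+_ (f≗g zero) (sumFin-cong (f≗g ∘ suc))

sumFin-+ : ∀ {n} (f g : Fin n → ℕ) → sumFin n (λ w → f w + g w) ≡ sumFin n f + sumFin n g
sumFin-+ {zero}  f g = refl
sumFin-+ {suc n} f g =
  trans (cong (f zero + g zero +_) (sumFin-+ (f ∘ suc) (g ∘ suc)))
        (+-CS.interchange (f zero) (g zero) (sumFin n (f ∘ suc)) (sumFin n (g ∘ suc)))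

sumFin-mono : ∀ {n} {f g : Fin n → ℕ} → (∀ w → f w ≤ g w) → sumFin n f ≤ sumFin n g
sumFin-mono {zero}  f≤g = z≤n
sumFin-mono {suc n} f≤g = +-mono-≤ (f≤g zero) (sumFin-mono (f≤g ∘ suc))

*-distribˡ-sumFin : ∀ {n} c (f : Fin n → ℕ) → c * sumFin n f ≡ sumFin n (λ w → c * f w)
*-distribˡ-sumFin {zero}  c f = *-zeroʳ c
*-distribˡ-sumFin {suc n} c f =
  trans (*-distribˡ-+ c (f zero) _) (cong (c * f zero +_) (*-distribˡ-sumFin c (f ∘ suc)))

sumFin-const-1 : ∀ n → sumFin n (const 1) ≡ n
sumFin-const-1 zero    = refl
sumFin-const-1 (suc n) = cong suc (sumFin-const-1 n)

sumFin-extract : ∀ {n} {f g : Fin n → ℕ} v → g v ≡ 0 → (∀ w → w ≢ v → g w ≡ f w) →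
                 sumFin n f ≡ f v + sumFin n g
sumFin-extract {suc n} {f} {g} zero g0≡0 g≗f =
  cong (f zero +_) (begin
    sumFin n (f ∘ suc)        ≡⟨ sumFin-cong (λ w → sym (g≗f (suc w) (Fin.0≢1+n ∘ sym))) ⟩
    sumFin n (g ∘ suc)        ≡⟨ cong (_+ sumFin n (g ∘ suc)) g0≡0 ⟨
    g zero + sumFin n (g ∘ suc) ∎)
  where open ≡-Reasoning
sumFin-extract {suc n} {f} {g} (suc v) gv≡0 g≗f = begin
  f zero + sumFin n (f ∘ suc)             ≡⟨ cong (f zero +_) (sumFin-extract v gv≡0 g≗f′) ⟩
  f zero + (f (suc v) + sumFin n (g ∘ suc)) ≡⟨ +-CS.x∙yz≈y∙xz (f zero) (f (suc v)) (sumFin n (g ∘ suc)) ⟩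
  f (suc v) + (f zero + sumFin n (g ∘ suc)) ≡⟨ cong (λ x → f (suc v) + (x + sumFin n (g ∘ suc))) g0≡f0 ⟨
  f (suc v) + (g zero + sumFin n (g ∘ suc)) ∎
  where
  open ≡-Reasoning
  g≗f′ : ∀ w → w ≢ v → g (suc w) ≡ f (suc w)
  g≗f′ w w≢v = g≗f (suc w) (w≢v ∘ Fin.suc-injective)
  g0≡f0 : g zero ≡ f zero
  g0≡f0 = g≗f zero Fin.0≢1+n

restrict : ∀ {n} → (Fin n → Bool) → (Fin n → ℕ) → Fin n → ℕ
restrict P f w = if P w then f w else 0

-- nbrSum G ℓ v is definitionally sumOver (adj G v) ℓ, and degree G v is count (adj G v).
sumOver : ∀ {n} → (Fin n → Bool) → (Fin n → ℕ) → ℕ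
sumOver {n} P f = sumFin n (restrict P f)

count : ∀ {n} → (Fin n → Bool) → ℕ
count P = sumOver P (const 1)

∣p∣≡count : ∀ {n} (p : Subset n) → ∣ p ∣ ≡ count (lookup p)
∣p∣≡count Vec.[]          = refl
∣p∣≡count (true Vec.∷ p)  = cong suc (∣p∣≡count p)
∣p∣≡count (false Vec.∷ p) = ∣p∣≡count p

sumOver-split : ∀ {n} (P Q : Fin n → Bool) f →
                sumOver P f ≡ sumOver (λ w → P w ∧ Q w) f + sumOver (λ w → P w ∧ not (Q w)) f
sumOver-split {n} P Q f = trans (sumFin-cong split) (sumFin-+ (restrict P∧Q f) (restrict P∧¬Q f))
  where
  P∧Q P∧¬Q : Fin n → Bool
  P∧Q  w = P w ∧ Q w
  P∧¬Q w = P w ∧ not (Q w)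
  split : ∀ w → restrict P f w ≡ restrict P∧Q f w + restrict P∧¬Q f w
  split w with P w | Q w
  ... | true  | true  = sym (+-identityʳ _)
  ... | true  | false = refl
  ... | false | _     = refl

sumOver-cong : ∀ {n} {P Q : Fin n → Bool} f → (∀ w → P w ≡ Q w) → sumOver P f ≡ sumOver Q f
sumOver-cong f P≗Q = sumFin-cong (λ w → cong (λ b → if b then f w else 0) (P≗Q w))

count+count-not : ∀ {n} (P : Fin n → Bool) → count P + count (not ∘ P) ≡ n
count+count-not {n} P = trans (sym (sumOver-split (const true) P (const 1))) (sumFin-const-1 n)

sumOver-mono : ∀ {n} P {f g : Fin n → ℕ} → (∀ w → f w ≤ g w) → sumOver P f ≤ sumOver P g
sumOver-mono P {f} {g} f≤g = sumFin-mono restrict-mono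
  where
  restrict-mono : ∀ w → restrict P f w ≤ restrict P g w
  restrict-mono w with P w
  ... | true  = f≤g w
  ... | false = z≤n

*-count : ∀ {n} (P : Fin n → Bool) c → c * count P ≡ sumOver P (const c)
*-count P c = trans (*-distribˡ-sumFin c (restrict P (const 1))) (sumFin-cong scale)
  where
  scale : ∀ w → c * restrict P (const 1) w ≡ restrict P (const c) w
  scale w with P w
  ... | true  = *-identityʳ c
  ... | false = *-zeroʳ c

sumOver-bounds : ∀ {n} P {ℓ : Fin n → ℕ} {a b} → (∀ w → a ≤ ℓ w × ℓ w ≤ b) →
                 a * count P ≤ sumOver P ℓ × sumOver P ℓ ≤ b * count P
sumOver-bounds P {a = a} {b} a≤ℓ≤b =
  ≤-trans (≤-reflexive (*-count P a)) (sumOver-mono P (proj₁ ∘ a≤ℓ≤b)) ,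
  ≤-trans (sumOver-mono P (proj₂ ∘ a≤ℓ≤b)) (≤-reflexive (sym (*-count P b)))

-- Removing the value i from ℕ: the analogue of Data.Fin.punchOut.
punchOutℕ : ℕ → ℕ → ℕ
punchOutℕ zero    j       = pred j
punchOutℕ (suc i) zero    = zero
punchOutℕ (suc i) (suc j) = suc (punchOutℕ i j)

punchOutℕ-< : ∀ {i j m} → j ≢ i → i < suc m → j < suc m → punchOutℕ i j < m
punchOutℕ-< {zero}  {zero}                j≢i _           _           = contradiction refl j≢i
punchOutℕ-< {zero}  {suc j}               _   _           (s≤s j<m)   = j<m
punchOutℕ-< {suc i} {zero}  {zero}        _   (s≤s ())    _
punchOutℕ-< {suc i} {zero}  {suc m}       _   _           _           = s≤s z≤n
punchOutℕ-< {suc i} {suc j} {zero}        _   (s≤s ())    _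
punchOutℕ-< {suc i} {suc j} {suc m}       j≢i (s≤s i<1+m) (s≤s j<1+m) =
  s≤s (punchOutℕ-< (j≢i ∘ cong suc) i<1+m j<1+m)

punchOutℕ-injective : ∀ {i j k} → j ≢ i → k ≢ i → punchOutℕ i j ≡ punchOutℕ i k → j ≡ k
punchOutℕ-injective {zero}  {zero}          j≢i _   _  = contradiction refl j≢i
punchOutℕ-injective {zero}  {suc j} {zero}  _   k≢i _  = contradiction refl k≢i
punchOutℕ-injective {zero}  {suc j} {suc k} _   _   eq = cong suc eq
punchOutℕ-injective {suc i} {zero}  {zero}  _   _   _  = refl
punchOutℕ-injective {suc i} {suc j} {suc k} j≢i k≢i eq =
  cong suc (punchOutℕ-injective (j≢i ∘ cong suc) (k≢i ∘ cong suc) (suc-injective eq))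

InjectiveOn : ∀ {n} → (Fin n → Bool) → (Fin n → ℕ) → Set
InjectiveOn P h = ∀ {u v} → P u ≡ true → P v ≡ true → h u ≡ h v → u ≡ v

count≤-injectiveOn-< : ∀ {n} (P : Fin n → Bool) (h : Fin n → ℕ) {m} → InjectiveOn P h →
                       (∀ v → P v ≡ true → h v < m) → count P ≤ m
count≤-injectiveOn-< {zero}  P h     inj bound = z≤n
count≤-injectiveOn-< {suc n} P h {m} inj bound with P zero in P0
... | false =
  count≤-injectiveOn-< (P ∘ suc) (h ∘ suc) (λ Pu Pv eq → Fin.suc-injective (inj Pu Pv eq)) (bound ∘ suc)
... | true with m | bound | bound zero P0
...   | suc m′ | bound | h0<m =
  s≤s (count≤-injectiveOn-< (P ∘ suc) (punchOutℕ (h zero) ∘ h ∘ suc) inj′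
         (λ v Pv → punchOutℕ-< (fresh Pv) h0<m (bound (suc v) Pv)))
  where
  fresh : ∀ {v} → P (suc v) ≡ true → h (suc v) ≢ h zero
  fresh Pv eq = Fin.0≢1+n (sym (inj Pv P0 eq))
  inj′ : InjectiveOn (P ∘ suc) (punchOutℕ (h zero) ∘ h ∘ suc)
  inj′ Pu Pv eq = Fin.suc-injective (inj Pu Pv (punchOutℕ-injective (fresh Pu) (fresh Pv) eq))

count≤-injectiveOn-window : ∀ {n} (P : Fin n → Bool) (h : Fin n → ℕ) {B m} → InjectiveOn P h →
                            (∀ v → P v ≡ true → B ≤ h v × h v < B + m) → count P ≤ m
count≤-injectiveOn-window P h {B} {m} inj bound = count≤-injectiveOn-< P (λ v → h v ∸ B) inj′ bound′
  where
  inj′ : InjectiveOn P (λ v → h v ∸ B)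
  inj′ {u} {v} Pu Pv eq = inj Pu Pv (∸-cancelʳ-≡ (proj₁ (bound u Pu)) (proj₁ (bound v Pv)) eq)
  bound′ : ∀ v → P v ≡ true → h v ∸ B < m
  bound′ v Pv with bound v Pv
  ... | B≤hv , hv<B+m = +-cancelˡ-< B _ m (subst (_< B + m) (sym (m+[n∸m]≡n B≤hv)) hv<B+m)

count≤-sandwich : ∀ {n} (P : Fin n → Bool) (x y w : Fin n → ℕ) {z a p b q} → InjectiveOn P x →
                  (∀ {v} → P v ≡ true → x v + y v ≡ z + w v) →
                  (∀ {v} → P v ≡ true → a < y v × y v ≤ a + p) →
                  (∀ {v} → P v ≡ true → b ≤ w v × w v ≤ b + q) →
                  count P ≤ p + q
count≤-sandwich P x y w {z} {a} {p} {b} {q} inj balance y-bounds w-bounds =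
  count≤-injectiveOn-window P (λ v → x v + (a + p)) (λ Pu Pv → inj Pu Pv ∘ +-cancelʳ-≡ (a + p) _ _)
    window
  where
  window : ∀ v → P v ≡ true → z + b ≤ x v + (a + p) × x v + (a + p) < z + b + (p + q)
  window v Pv = lower , upper
    where
    open ≤-Reasoning
    lower : z + b ≤ x v + (a + p)
    lower = begin
      z + b         ≤⟨ +-monoʳ-≤ z (proj₁ (w-bounds Pv)) ⟩
      z + w v       ≡⟨ balance Pv ⟨
      x v + y v     ≤⟨ +-monoʳ-≤ (x v) (proj₂ (y-bounds Pv)) ⟩
      x v + (a + p) ∎
    upper : x v + (a + p) < z + b + (p + q)
    upper = begin-strict
      x v + (a + p)   <⟨ +-monoʳ-< (x v) (+-monoˡ-< p (proj₁ (y-bounds Pv))) ⟩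
      x v + (y v + p) ≡⟨ +-assoc (x v) (y v) p ⟨
      x v + y v + p   ≡⟨ cong (_+ p) (balance Pv) ⟩
      z + w v + p     ≤⟨ +-monoˡ-≤ p (+-monoʳ-≤ z (proj₂ (w-bounds Pv))) ⟩
      z + (b + q) + p ≡⟨ solve (z ∷ b ∷ q ∷ p ∷ []) ⟩
      z + b + (p + q) ∎

module CliqueSums {n} (G : Graph n) (K : Fin n → Bool)
                  (isClique : ∀ {u v} → K u ≡ true → K v ≡ true → u ≢ v → Adjacent G u v) where

  inNbr outNbr nonNbr : Fin n → Fin n → Bool
  inNbr  v w = adj G v w ∧ K w
  outNbr v w = adj G v w ∧ not (K w)
  nonNbr v w = not (K w) ∧ not (adj G v w)

  sumOver-clique : ∀ ℓ {v} → K v ≡ true → sumOver K ℓ ≡ ℓ v + sumOver (inNbr v) ℓ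
  sumOver-clique ℓ {v} Kv =
    trans (sumFin-extract v (cong (λ b → if b ∧ K v then ℓ v else 0) (irrefl G v)) off)
          (cong (λ b → (if b then ℓ v else 0) + sumOver (inNbr v) ℓ) Kv)
    where
    off : ∀ w → w ≢ v → restrict (inNbr v) ℓ w ≡ restrict K ℓ w
    off w w≢v with adj G v w in vw | K w in Kw
    ... | true  | _     = refl
    ... | false | false = refl
    ... | false | true  = contradiction (trans (sym vw) (isClique Kv Kw (w≢v ∘ sym))) λ ()

  closed-nbrSum : ∀ ℓ {v} → K v ≡ true → nbrSum G ℓ v + ℓ v ≡ sumOver K ℓ + sumOver (outNbr v) ℓ
  closed-nbrSum ℓ {v} Kv = begin
    nbrSum G ℓ v + ℓ v     ≡⟨ cong (_+ ℓ v) (sumOver-split (adj G v) K ℓ) ⟩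
    inside + outside + ℓ v ≡⟨ +-CS.xy∙z≈zx∙y inside outside (ℓ v) ⟩
    ℓ v + inside + outside ≡⟨ cong (_+ outside) (sumOver-clique ℓ Kv) ⟨
    sumOver K ℓ + outside  ∎
    where
    open ≡-Reasoning
    inside outside : ℕ
    inside  = sumOver (inNbr v) ℓ
    outside = sumOver (outNbr v) ℓ

  outNbr+nonNbr : ∀ ℓ v → sumOver (outNbr v) ℓ + sumOver (nonNbr v) ℓ ≡ sumOver (not ∘ K) ℓ
  outNbr+nonNbr ℓ v = begin
    sumOver (outNbr v) ℓ + sumOver (nonNbr v) ℓ
      ≡⟨ cong (_+ sumOver (nonNbr v) ℓ) (sumOver-cong ℓ (λ w → ∧-comm (adj G v w) (not (K w)))) ⟩
    sumOver (λ w → not (K w) ∧ adj G v w) ℓ + sumOver (nonNbr v) ℓ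
      ≡⟨ sumOver-split (not ∘ K) (adj G v) ℓ ⟨
    sumOver (not ∘ K) ℓ ∎
    where open ≡-Reasoning

  nbrSum-injectiveOn : ∀ {ℓ} → (∀ u v → Adjacent G u v → nbrSum G ℓ u ≢ nbrSum G ℓ v) →
                       InjectiveOn K (nbrSum G ℓ)
  nbrSum-injectiveOn distinct {u} {v} Ku Kv eq =
    decidable-stable (u Fin.≟ v) (λ u≢v → distinct u v (isClique Ku Kv u≢v) eq)

  clique-bound : ∀ {k ℓ} → IsAdditiveLabeling G k ℓ → count K ≤ k * (count (not ∘ K) + 1)
  clique-bound {k} {ℓ} (ℓ-range , distinct) = begin
    count K
      ≤⟨ count≤-sandwich K (nbrSum G ℓ) ℓ (λ v → sumOver (outNbr v) ℓ)
           (nbrSum-injectiveOn distinct) (closed-nbrSum ℓ) (λ {v} _ → ℓ-range v) (λ {v} _ → z≤n , outNbr≤ v) ⟩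
    k + k * count (not ∘ K) ≡⟨ *-suc k (count (not ∘ K)) ⟨
    k * suc (count (not ∘ K)) ≡⟨ cong (k *_) (+-comm 1 (count (not ∘ K))) ⟩
    k * (count (not ∘ K) + 1) ∎
    where
    open ≤-Reasoning
    outNbr≤ : ∀ v → sumOver (outNbr v) ℓ ≤ k * count (not ∘ K)
    outNbr≤ v = ≤-trans (≤-trans (m≤m+n _ _) (≤-reflexive (outNbr+nonNbr ℓ v)))
                        (proj₂ (sumOver-bounds (not ∘ K) ℓ-range))

  module _ {d} (regular : ∀ v → degree G v ≡ d) {v₀} (Kv₀ : K v₀ ≡ true) where

    count-outNbr : ∀ {v} → K v ≡ true → count (outNbr v) ≡ count (outNbr v₀)
    count-outNbr Kv = +-cancelˡ-≡ (count K) _ _ (trans (closed-count Kv) (sym (closed-count Kv₀)))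
      where
      closed-count : ∀ {v} → K v ≡ true → count K + count (outNbr v) ≡ d + 1
      closed-count {v} Kv = trans (sym (closed-nbrSum (const 1) Kv)) (cong (_+ 1) (regular v))

    count-nonNbr : ∀ {v} → K v ≡ true → count (nonNbr v) ≡ count (nonNbr v₀)
    count-nonNbr {v} Kv = +-cancelˡ-≡ (count (outNbr v₀)) _ _ (begin
      count (outNbr v₀) + count (nonNbr v)  ≡⟨ cong (_+ count (nonNbr v)) (count-outNbr Kv) ⟨
      count (outNbr v) + count (nonNbr v)   ≡⟨ outNbr+nonNbr (const 1) v ⟩
      count (not ∘ K)                       ≡⟨ outNbr+nonNbr (const 1) v₀ ⟨
      count (outNbr v₀) + count (nonNbr v₀) ∎)
      where open ≡-Reasoning

    module _ {ℓ} (ℓ-range : ∀ w → 1 ≤ ℓ w × ℓ w ≤ 2)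
             (distinct : ∀ u v → Adjacent G u v → nbrSum G ℓ u ≢ nbrSum G ℓ v) where

      count≤sumOver≤count+count : ∀ P → count P ≤ sumOver P ℓ × sumOver P ℓ ≤ count P + count P
      count≤sumOver≤count+count P with sumOver-bounds P ℓ-range
      ... | lower , upper = subst (_≤ sumOver P ℓ) (*-identityˡ (count P)) lower ,
                            subst (sumOver P ℓ ≤_) (cong (count P +_) (+-identityʳ (count P))) upper

      count≤2+count-outNbr : count K ≤ 2 + count (outNbr v₀)
      count≤2+count-outNbr =
        count≤-sandwich K (nbrSum G ℓ) ℓ (λ v → sumOver (outNbr v) ℓ) (nbrSum-injectiveOn distinct)
          (closed-nbrSum ℓ) (λ {v} _ → ℓ-range v) outNbr-bounds
        where
        c : ℕ
        c = count (outNbr v₀)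
        outNbr-bounds : ∀ {v} → K v ≡ true → c ≤ sumOver (outNbr v) ℓ × sumOver (outNbr v) ℓ ≤ c + c
        outNbr-bounds {v} Kv =
          subst (λ c → c ≤ _ × _ ≤ c + c) (count-outNbr Kv) (count≤sumOver≤count+count (outNbr v))

      count≤count-nonNbr+2 : count K ≤ count (nonNbr v₀) + 2
      count≤count-nonNbr+2 = subst (count K ≤_) (+-identityʳ _)
        (count≤-sandwich K (nbrSum G ℓ) (λ v → ℓ v + sumOver (nonNbr v) ℓ) (const 0)
          (nbrSum-injectiveOn distinct) balance ℓ+nonNbr-bounds (λ _ → z≤n , z≤n))
        where
        c′ : ℕ
        c′ = count (nonNbr v₀)

        balance : ∀ {v} → K v ≡ true →
                  nbrSum G ℓ v + (ℓ v + sumOver (nonNbr v) ℓ) ≡ sumOver K ℓ + sumOver (not ∘ K) ℓ + 0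
        balance {v} Kv = begin
          nbrSum G ℓ v + (ℓ v + far)            ≡⟨ +-assoc (nbrSum G ℓ v) (ℓ v) far ⟨
          nbrSum G ℓ v + ℓ v + far              ≡⟨ cong (_+ far) (closed-nbrSum ℓ Kv) ⟩
          sumOver K ℓ + near + far              ≡⟨ +-assoc (sumOver K ℓ) near far ⟩
          sumOver K ℓ + (near + far)            ≡⟨ cong (sumOver K ℓ +_) (outNbr+nonNbr ℓ v) ⟩
          sumOver K ℓ + sumOver (not ∘ K) ℓ     ≡⟨ +-identityʳ _ ⟨
          sumOver K ℓ + sumOver (not ∘ K) ℓ + 0 ∎
          where
          open ≡-Reasoning
          near far : ℕ
          near = sumOver (outNbr v) ℓ
          far  = sumOver (nonNbr v) ℓ

        ℓ+nonNbr-bounds : ∀ {v} → K v ≡ true →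
                          c′ < ℓ v + sumOver (nonNbr v) ℓ × ℓ v + sumOver (nonNbr v) ℓ ≤ c′ + (c′ + 2)
        ℓ+nonNbr-bounds {v} Kv with subst (λ c → c ≤ _ × _ ≤ c + c) (count-nonNbr Kv)
                                      (count≤sumOver≤count+count (nonNbr v))
        ... | lower , upper =
          +-mono-≤ (proj₁ (ℓ-range v)) lower ,
          ≤-trans (+-mono-≤ (proj₂ (ℓ-range v)) upper)
                  (≤-reflexive (trans (+-comm 2 (c′ + c′)) (+-assoc c′ c′ 2)))

      regular-clique-bound : 3 * count K ≤ n + 4
      regular-clique-bound = begin
        3 * ω
          ≤⟨ +-monoʳ-≤ ω (+-mono-≤ count≤2+count-outNbr (+-monoˡ-≤ 0 count≤count-nonNbr+2)) ⟩
        ω + (2 + c + (c′ + 2 + 0)) ≡⟨ rearrange ω c c′ ⟩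
        ω + (c + c′) + 4           ≡⟨ cong (λ m → ω + m + 4) (outNbr+nonNbr (const 1) v₀) ⟩
        ω + count (not ∘ K) + 4    ≡⟨ cong (_+ 4) (count+count-not K) ⟩
        n + 4                      ∎
        where
        open ≤-Reasoning
        ω c c′ : ℕ
        ω = count K
        c = count (outNbr v₀)
        c′ = count (nonNbr v₀)
        rearrange : ∀ x y z → x + (2 + y + (z + 2 + 0)) ≡ x + (y + z) + 4
        rearrange = solve-∀

theorem2 : ∀ (n : ℕ) (G : Graph n) (ω : ℕ) → IsCliqueNumber G ω →
    (∀ k → HasAdditiveLabeling G k → ω ≤ k * (n ∸ ω + 1))
    × (Regular G → n + 4 < 3 * ω → ∀ k → HasAdditiveLabeling G k → 3 ≤ k)
theorem2 n G ω ((S , S-isClique , ∣S∣≡ω) , _) = clique-number-bound , regular-bound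
  where
  K : Fin n → Bool
  K = lookup S
  open CliqueSums G K (λ Ku Kv → S-isClique _ _ (lookup⇒[]= _ S Ku) (lookup⇒[]= _ S Kv))

  ω≡count : ω ≡ count K
  ω≡count = trans (sym ∣S∣≡ω) (∣p∣≡count S)

  n∸ω≡count : n ∸ ω ≡ count (not ∘ K)
  n∸ω≡count = trans (cong₂ _∸_ (sym (count+count-not K)) ω≡count) (m+n∸m≡n (count K) _)

  clique-vertex : ω ≢ 0 → ∃ λ v → K v ≡ true
  clique-vertex ω≢0 with nonempty? S
  ... | yes (v , v∈S) = v , []=⇒lookup v∈S
  ... | no  S-empty   =
    contradiction (trans (sym ∣S∣≡ω) (trans (cong ∣_∣ (Empty-unique S-empty)) (∣⊥∣≡0 n))) ω≢0

  clique-number-bound : ∀ k → HasAdditiveLabeling G k → ω ≤ k * (n ∸ ω + 1)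
  clique-number-bound k (ℓ , labeling) =
    subst₂ (λ a b → a ≤ k * (b + 1)) (sym ω≡count) (sym n∸ω≡count) (clique-bound labeling)

  regular-bound : Regular G → n + 4 < 3 * ω → ∀ k → HasAdditiveLabeling G k → 3 ≤ k
  regular-bound (d , regular) n+4<3ω k (ℓ , ℓ-range , distinct) = ≮⇒≥ λ k<3 →
    let ℓ-range′ w = proj₁ (ℓ-range w) , ≤-trans (proj₂ (ℓ-range w)) (s≤s⁻¹ k<3)
        (v₀ , Kv₀) = clique-vertex (m<n⇒n≢0 n+4<3ω ∘ cong (3 *_))
    in <⇒≱ n+4<3ω (subst (λ m → 3 * m ≤ n + 4) (sym ω≡count)
                       (regular-clique-bound regular Kv₀ ℓ-range′ distinct))
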